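{- Let $B$ be a finite Boolean algebra. Then the map $\sigma\colon\mathrm{UC}(B)\to\mathrm{SC}(\mathrm{Atom}(B))$ given by $\sigma(\mathscr K)=\mathscr K\cap 2^{\mathrm{Atom}(B)}_+$ is well defined and is an order isomorphism with respect to set inclusion.
   Context: Let $B$ be a non-trivial Boolean algebra with order $\le$ and join $+$; $\mathrm{Atom}(B)$ is its set of atoms and $2^X_+$ denotes the set of non-empty subsets of a set $X$. For $F,G\subseteq B$ put $F+G=\{f+g: f\in F,\ g\in G\}$, and write $F\preceq G$ iff for every $g\in G$ there is $f\in F$ with $f\le g$. An ultracontact on $B$ is a family $\mathscr K\subseteq 2^B$ such that for all $F,G\subseteq B$: (K0) $\emptyset\notin\mathscr K$; (K1) if $0\in F$ then $F\notin\mathscr K$; (K2) if $x\neq 0$ then $\{x\}\in\mathscr K$; (K3) if $F\preceq G$, $G\neq\emptyset$ and $F\in\mathscr K$, then $G\in\mathscr K$; (K4) if $F+G\in\mathscr K$ then $F\in\mathscr K$ or $G\in\mathscr K$. $\mathrm{UC}(B)$ is the set of ultracontacts on $B$. For a set $V$, $\mathrm{SC}(V)$ is the set of all families $\Sigma$ of finite non-empty subsets of $V$ such that $\{v\}\in\Sigma$ for every $v\in V$ and, whenever $S\in\Sigma$ and $\emptyset\neq T\subseteq S$, $T\in\Sigma$ (i.e. abstract simplicial complexes on vertex set $V$). Both $\mathrm{UC}(B)$ and $\mathrm{SC}(V)$ are ordered by inclusion. -}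

module Defs where

open import Data.Nat using (ℕ)
open import Data.Bool using (Bool; _∧_; T)
open import Data.Fin using (Fin; _≟_)
open import Data.Fin.Properties using (any?; all?)
open import Data.Fin.Subset using (Subset; _∈_; _⊆_; Nonempty; ⁅_⁆) renaming (⊥ to ∅)
open import Data.Fin.Subset.Properties using (_∈?_; nonempty?)
open import Data.Product using (Σ; ∃; _×_; _,_)
open import Data.Sum using (_⊎_)
open import Data.Vec using (tabulate)
open import Relation.Binary.PropositionalEquality using (_≡_; _≢_)
open import Relation.Nullary using (¬_; Dec)
open import Relation.Nullary.Decidable using (⌊_⌋; _×-dec_; _⊎-dec_; _→-dec_; ¬?)
open import Algebra.Core using (Op₁; Op₂)
import Algebra.Lattice.Structures as LS

-- A finite Boolean algebra: (up to isomorphism) its carrier is Fin n for some n,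
-- with propositional equality as the equality of the algebra.
record FinBA (n : ℕ) : Set where
  field
    _+_ : Op₂ (Fin n)
    _·_ : Op₂ (Fin n)
    -_  : Op₁ (Fin n)
    𝟙   : Fin n
    𝟘   : Fin n
    isBooleanAlgebra : LS.IsBooleanAlgebra (_≡_ {A = Fin n}) _+_ _·_ -_ 𝟙 𝟘

-- Families of subsets of B (elements of 2^(2^B)); B finite so every family is decidable.
Family : ℕ → Set
Family n = Subset n → Bool

_∈ᶠ_ : ∀ {n} → Subset _ → Family n → Set
F ∈ᶠ 𝒦 = T (𝒦 F)

_⊑_ : ∀ {n} → Family n → Family n → Set
𝒦 ⊑ 𝒦′ = ∀ F → F ∈ᶠ 𝒦 → F ∈ᶠ 𝒦′

_≐_ : ∀ {n} → Family n → Family n → Set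
𝒦 ≐ 𝒦′ = (𝒦 ⊑ 𝒦′) × (𝒦′ ⊑ 𝒦)

module _ {n : ℕ} (B : FinBA n) where
  open FinBA B

  _≤_ : Fin n → Fin n → Set
  x ≤ y = (x + y) ≡ y

  _≤?_ : ∀ x y → Dec (x ≤ y)
  x ≤? y = (x + y) ≟ y

  IsAtom : Fin n → Set
  IsAtom a = (a ≢ 𝟘) × (∀ b → b ≤ a → (b ≡ 𝟘) ⊎ (b ≡ a))

  isAtom? : ∀ a → Dec (IsAtom a)
  isAtom? a = ¬? (a ≟ 𝟘) ×-dec all? (λ b → (b ≤? a) →-dec ((b ≟ 𝟘) ⊎-dec (b ≟ a)))

  AtomSet₊ : Subset n → Set
  AtomSet₊ S = Nonempty S × (∀ a → a ∈ S → IsAtom a)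

  atomSet₊? : ∀ S → Dec (AtomSet₊ S)
  atomSet₊? S = nonempty? S ×-dec all? (λ a → (a ∈? S) →-dec isAtom? a)

  _⊕_ : Subset n → Subset n → Subset n
  F ⊕ G = tabulate (λ x → ⌊ any? (λ f → any? (λ g →
            (f ∈? F) ×-dec (g ∈? G) ×-dec (x ≟ (f + g)))) ⌋)

  _⪯_ : Subset n → Subset n → Set
  F ⪯ G = ∀ g → g ∈ G → ∃ λ f → (f ∈ F) × (f ≤ g)

  record IsUltracontact (𝒦 : Family n) : Set where
    field
      K0 : ¬ (∅ ∈ᶠ 𝒦)
      K1 : ∀ F → 𝟘 ∈ F → ¬ (F ∈ᶠ 𝒦)
      K2 : ∀ x → x ≢ 𝟘 → ⁅ x ⁆ ∈ᶠ 𝒦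
      K3 : ∀ F G → F ⪯ G → Nonempty G → F ∈ᶠ 𝒦 → G ∈ᶠ 𝒦
      K4 : ∀ F G → (F ⊕ G) ∈ᶠ 𝒦 → (F ∈ᶠ 𝒦) ⊎ (G ∈ᶠ 𝒦)

  -- abstract simplicial complexes on vertex set Atom(B), viewed as families of subsets of B
  record IsSimplicialComplexOnAtoms (Σ′ : Family n) : Set where
    field
      faces    : ∀ S → S ∈ᶠ Σ′ → AtomSet₊ S
      vertices : ∀ v → IsAtom v → ⁅ v ⁆ ∈ᶠ Σ′
      downward : ∀ S T′ → S ∈ᶠ Σ′ → Nonempty T′ → T′ ⊆ S → T′ ∈ᶠ Σ′

  σ : Family n → Family n
  σ 𝒦 S = 𝒦 S ∧ ⌊ atomSet₊? S ⌋

{-# OPTIONS --safe #-}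
-- Atoms of B are join-prime, and every nonzero element of B lies above an atom. In an
-- ultracontact 𝒦 a member R ∪ {f} with f not an atom can be pushed down: writing f = b + c
-- with b, c < f gives R ∪ {f} ⪯ (R ∪ {b}) + (R ∪ {c}), so by (K3) and (K4) R ∪ {b} or R ∪ {c}
-- lies in 𝒦. Replacing the elements of F ∈ 𝒦 one at a time by atoms thus yields an atom set
-- S ∈ 𝒦 with S ⪯ F, so 𝒦 is recovered from σ(𝒦) as the sets lying ⪯-above one of its faces,
-- and σ is an order embedding. Conversely, for a complex Σ the non-empty sets ⪯-above a face
-- of Σ form an ultracontact, (K4) holding by join-primeness of atoms, whose atom sets are
-- exactly the faces of Σ, as faces are closed downward.
module Submission where

open import Defs
  using (FinBA; Family; _∈ᶠ_; _⊑_; _≐_; IsUltracontact; IsSimplicialComplexOnAtoms; σ)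
import Defs as D
open import Data.Nat using (ℕ)
open import Data.Bool.Properties using (T-∧; T-≡)
open import Data.Fin using (Fin; _≟_)
open import Data.Fin.Properties using (any?; all?; ¬∀⟶∃¬)
open import Data.Fin.Subset
  using (Subset; _∈_; _∉_; _⊆_; _∪_; _─_; _-_; Nonempty; ⁅_⁆; inside)
open import Data.Fin.Subset.Properties
  using ( _∈?_; nonempty?; anySubset?; Empty-unique; ∉⊥; x∈⁅x⁆; x∈⁅y⁆⇒x≡y; x∉⁅y⁆⇒x≢y
        ; x∈p∪q⁺; x∈p∪q⁻; p─q⊆p; x∈p∧x≢y⇒x∈p-y)
open import Data.Fin.Induction using (spo-wellFounded)
open import Data.Product using (∃; ∃₂; _×_; _,_; proj₁; proj₂)
open import Data.Sum using (_⊎_; inj₁; inj₂; [_,_]′; map₂)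
open import Data.Empty using (⊥-elim)
open import Data.Vec using (_∷_; tabulate; here; there)
open import Data.Vec.Properties using ([]=⇒lookup; lookup⇒[]=; lookup∘tabulate)
open import Data.List using (List; []; _∷_; allFin)
open import Data.List.Relation.Unary.Any using (tail)
open import Data.List.Membership.Propositional using () renaming (_∈_ to _∈ˡ_)
open import Data.List.Membership.Propositional.Properties using (∈-allFin)
open import Level using (0ℓ)
open import Relation.Binary.PropositionalEquality
open import Relation.Binary.Structures using (IsStrictPartialOrder)
open import Relation.Unary using (Pred; Decidable)
open import Relation.Nullary using (¬_; Dec; yes; no)
open import Relation.Nullary.Decidable
  using (⌊_⌋; _×-dec_; _⊎-dec_; _→-dec_; ¬?; toWitness; fromWitness; T?)
open import Induction.WellFounded using (Acc; acc; WellFounded)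
open import Function.Bundles using (_⇔_; mk⇔; Equivalence)
open import Algebra.Lattice.Structures using (module IsBooleanAlgebra)
open import Algebra.Lattice.Bundles using (BooleanAlgebra)
import Algebra.Lattice.Properties.BooleanAlgebra as BooleanAlgebraProperties

x∈p─q⇒x∉q : ∀ {n} {p q : Subset n} {x} → x ∈ p ─ q → x ∉ q
x∈p─q⇒x∉q {p = _ ∷ _} {q = _ ∷ _}      (there x∈p─q) (there x∈q) = x∈p─q⇒x∉q x∈p─q x∈q
x∈p─q⇒x∉q {p = _ ∷ _} {q = inside ∷ _} ()            here

x∈p∪⁅x⁆ : ∀ {n} (p : Subset n) x → x ∈ p ∪ ⁅ x ⁆
x∈p∪⁅x⁆ _ x = x∈p∪q⁺ (inj₂ (x∈⁅x⁆ x))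

x∈p⇒p-x∪⁅x⁆⊆p : ∀ {n} {p : Subset n} {x} → x ∈ p → (p - x) ∪ ⁅ x ⁆ ⊆ p
x∈p⇒p-x∪⁅x⁆⊆p {p = p} {x} x∈p y∈ with x∈p∪q⁻ (p - x) ⁅ x ⁆ y∈
... | inj₁ y∈p-x = p─q⊆p p ⁅ x ⁆ y∈p-x
... | inj₂ y∈⁅x⁆ = subst (_∈ p) (sym (x∈⁅y⁆⇒x≡y x y∈⁅x⁆)) x∈p

∈-tabulate⌊⌋ : ∀ {n p} {P : Pred (Fin n) p} (P? : Decidable P) {x} →
               x ∈ tabulate (λ y → ⌊ P? y ⌋) ⇔ P x
∈-tabulate⌊⌋ P? {x} = mk⇔
  (λ x∈ → toWitness {a? = P? x}
            (Equivalence.from T-≡ (trans (sym (lookup∘tabulate _ x)) ([]=⇒lookup x∈))))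
  (λ Px → lookup⇒[]= x _
            (trans (lookup∘tabulate _ x) (Equivalence.to T-≡ (fromWitness {a? = P? x} Px))))

module _ {n : ℕ} (B : FinBA n) where
  open FinBA B
  open IsBooleanAlgebra isBooleanAlgebra
    using ( ∨-comm; ∨-assoc; ∧-comm; ∧-assoc; ∨-absorbs-∧; ∧-absorbs-∨
          ; ∨-distribˡ-∧; ∧-distribˡ-∨; ∨-complementʳ; ∧-complementʳ )

  booleanAlgebra : BooleanAlgebra 0ℓ 0ℓ
  booleanAlgebra = record { isBooleanAlgebra = isBooleanAlgebra }

  open BooleanAlgebraProperties booleanAlgebra using (∨-identityʳ; ∧-identityʳ; ∨-idem)

  infix 4 _≤_ _<_ _⪯_

  _≤_ : Fin n → Fin n → Set
  _≤_ = D._≤_ B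

  _≤?_ : ∀ x y → Dec (x ≤ y)
  _≤?_ = D._≤?_ B

  IsAtom : Fin n → Set
  IsAtom = D.IsAtom B

  isAtom? : ∀ a → Dec (IsAtom a)
  isAtom? = D.isAtom? B

  Atomic : Subset n → Set
  Atomic S = ∀ a → a ∈ S → IsAtom a

  AtomSet₊ : Subset n → Set
  AtomSet₊ = D.AtomSet₊ B

  _⊕_ : Subset n → Subset n → Subset n
  _⊕_ = D._⊕_ B

  _⪯_ : Subset n → Subset n → Set
  _⪯_ = D._⪯_ B

  ≤-refl : ∀ x → x ≤ x
  ≤-refl = ∨-idem

  ≤-trans : ∀ {x y z} → x ≤ y → y ≤ z → x ≤ z
  ≤-trans {x} {y} {z} x≤y y≤z = begin
    x + z        ≡⟨ cong (x +_) (sym y≤z) ⟩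
    x + (y + z)  ≡⟨ sym (∨-assoc x y z) ⟩
    (x + y) + z  ≡⟨ cong (_+ z) x≤y ⟩
    y + z        ≡⟨ y≤z ⟩
    z            ∎
    where open ≡-Reasoning

  ≤-antisym : ∀ {x y} → x ≤ y → y ≤ x → x ≡ y
  ≤-antisym {x} {y} x≤y y≤x = trans (sym y≤x) (trans (∨-comm y x) x≤y)

  x≤x+y : ∀ x y → x ≤ x + y
  x≤x+y x y = trans (sym (∨-assoc x x y)) (cong (_+ y) (∨-idem x))

  y≤x+y : ∀ x y → y ≤ x + y
  y≤x+y x y = subst (y ≤_) (∨-comm y x) (x≤x+y y x)

  x·y≤x : ∀ x y → x · y ≤ x
  x·y≤x x y = trans (∨-comm _ x) (∨-absorbs-∧ x y)

  ≤⇒·≡ : ∀ {x y} → x ≤ y → x · y ≡ x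
  ≤⇒·≡ {x} x≤y = trans (cong (x ·_) (sym x≤y)) (∧-absorbs-∨ x _)

  ·≡⇒≤ : ∀ {x y} → x · y ≡ x → x ≤ y
  ·≡⇒≤ {x} {y} x·y≡x = begin
    x + y        ≡⟨ cong (_+ y) (sym x·y≡x) ⟩
    (x · y) + y  ≡⟨ ∨-comm _ y ⟩
    y + (x · y)  ≡⟨ cong (y +_) (∧-comm x y) ⟩
    y + (y · x)  ≡⟨ ∨-absorbs-∧ y x ⟩
    y            ∎
    where open ≡-Reasoning

  ≤𝟘⇒≡𝟘 : ∀ {x} → x ≤ 𝟘 → x ≡ 𝟘
  ≤𝟘⇒≡𝟘 {x} = trans (sym (∨-identityʳ x))

  _<_ : Fin n → Fin n → Set
  x < y = x ≤ y × x ≢ y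

  <-isStrictPartialOrder : IsStrictPartialOrder _≡_ _<_
  <-isStrictPartialOrder = record
    { isEquivalence = isEquivalence
    ; irrefl        = λ { refl (_ , x≢x) → x≢x refl }
    ; trans         = λ { (x≤y , x≢y) (y≤z , _) →
                            ≤-trans x≤y y≤z , λ { refl → x≢y (≤-antisym x≤y y≤z) } }
    ; <-resp-≈      = (λ { refl x<y → x<y }) , (λ { refl x<y → x<y })
    }

  <-wellFounded : WellFounded _<_
  <-wellFounded = spo-wellFounded <-isStrictPartialOrder

  atom-joinPrime : ∀ {a f g} → IsAtom a → a ≤ f + g → a ≤ f ⊎ a ≤ g
  atom-joinPrime {a} {f} {g} (a≢𝟘 , a-minimal) a≤f+g
    with a-minimal (a · f) (x·y≤x a f) | a-minimal (a · g) (x·y≤x a g)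
  ... | inj₂ a·f≡a | _           = inj₁ (·≡⇒≤ a·f≡a)
  ... | inj₁ _     | inj₂ a·g≡a  = inj₂ (·≡⇒≤ a·g≡a)
  ... | inj₁ a·f≡𝟘 | inj₁ a·g≡𝟘  = ⊥-elim (a≢𝟘 (begin
    a                  ≡⟨ sym (≤⇒·≡ a≤f+g) ⟩
    a · (f + g)        ≡⟨ ∧-distribˡ-∨ a f g ⟩
    (a · f) + (a · g)  ≡⟨ cong₂ _+_ a·f≡𝟘 a·g≡𝟘 ⟩
    𝟘 + 𝟘              ≡⟨ ∨-idem 𝟘 ⟩
    𝟘                  ∎))
    where open ≡-Reasoning

  nonAtom⇒properPart : ∀ {f} → f ≢ 𝟘 → ¬ IsAtom f → ∃ λ b → b ≢ 𝟘 × b < f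
  nonAtom⇒properPart {f} f≢𝟘 ¬atom
    with ¬∀⟶∃¬ n _ (λ b → (b ≤? f) →-dec ((b ≟ 𝟘) ⊎-dec (b ≟ f)))
                   (λ trivial → ¬atom (f≢𝟘 , trivial))
  ... | b , ¬trivial with b ≤? f
  ... | no b≰f  = ⊥-elim (¬trivial (λ b≤f → ⊥-elim (b≰f b≤f)))
  ... | yes b≤f =
    b , (λ b≡𝟘 → ¬trivial (λ _ → inj₁ b≡𝟘)) , b≤f , (λ b≡f → ¬trivial (λ _ → inj₂ b≡f))

  relComplement-+ : ∀ {b f} → b ≤ f → b + (f · (- b)) ≡ f
  relComplement-+ {b} {f} b≤f = begin
    b + (f · (- b))        ≡⟨ ∨-distribˡ-∧ b f (- b) ⟩
    (b + f) · (b + (- b))  ≡⟨ cong₂ _·_ b≤f (∨-complementʳ b) ⟩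
    f · 𝟙                  ≡⟨ ∧-identityʳ f ⟩
    f                      ∎
    where open ≡-Reasoning

  relComplement-< : ∀ {b f} → b ≢ 𝟘 → b ≤ f → f · (- b) < f
  relComplement-< {b} {f} b≢𝟘 b≤f = x·y≤x f (- b) , λ c≡f → b≢𝟘 (begin
    b                  ≡⟨ sym (≤⇒·≡ b≤f) ⟩
    b · f              ≡⟨ cong (b ·_) (sym c≡f) ⟩
    b · (f · (- b))    ≡⟨ sym (∧-assoc b f (- b)) ⟩
    (b · f) · (- b)    ≡⟨ cong (_· (- b)) (≤⇒·≡ b≤f) ⟩
    b · (- b)          ≡⟨ ∧-complementʳ b ⟩
    𝟘                  ∎)
    where open ≡-Reasoning

  nonAtom-split : ∀ {f} → f ≢ 𝟘 → ¬ IsAtom f → ∃₂ λ b c → b < f × c < f × b + c ≡ f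
  nonAtom-split f≢𝟘 ¬atom with nonAtom⇒properPart f≢𝟘 ¬atom
  ... | b , b≢𝟘 , (b≤f , b≢f) =
    b , _ , (b≤f , b≢f) , relComplement-< b≢𝟘 b≤f , relComplement-+ b≤f

  atom-below : ∀ {x} → x ≢ 𝟘 → ∃ λ a → IsAtom a × a ≤ x
  atom-below {x} = go (<-wellFounded x)
    where
    go : ∀ {x} → Acc _<_ x → x ≢ 𝟘 → ∃ λ a → IsAtom a × a ≤ x
    go {x} (acc rec) x≢𝟘 with isAtom? x
    ... | yes x-atom = x , x-atom , ≤-refl x
    ... | no ¬atom with nonAtom⇒properPart x≢𝟘 ¬atom
    ... | b , b≢𝟘 , b<x with go (rec b<x) b≢𝟘
    ... | a , a-atom , a≤b = a , a-atom , ≤-trans a≤b (proj₁ b<x)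

  ∈⊕⇔ : ∀ {F G x} → x ∈ F ⊕ G ⇔ (∃₂ λ f g → f ∈ F × g ∈ G × x ≡ f + g)
  ∈⊕⇔ {F} {G} =
    ∈-tabulate⌊⌋ (λ x → any? (λ f → any? (λ g → (f ∈? F) ×-dec (g ∈? G) ×-dec (x ≟ (f + g)))))

  ∈⊕⁺ : ∀ {F G f g} → f ∈ F → g ∈ G → f + g ∈ F ⊕ G
  ∈⊕⁺ f∈F g∈G = Equivalence.from ∈⊕⇔ (_ , _ , f∈F , g∈G , refl)

  ∈⊕⁻ : ∀ {F G x} → x ∈ F ⊕ G → ∃₂ λ f g → f ∈ F × g ∈ G × x ≡ f + g
  ∈⊕⁻ = Equivalence.to ∈⊕⇔

  ⪯-refl : ∀ F → F ⪯ F
  ⪯-refl F g g∈F = g , g∈F , ≤-refl g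

  ⪯-trans : ∀ {F G H} → F ⪯ G → G ⪯ H → F ⪯ H
  ⪯-trans F⪯G G⪯H h h∈H with G⪯H h h∈H
  ... | g , g∈G , g≤h with F⪯G g g∈G
  ... | f , f∈F , f≤g = f , f∈F , ≤-trans f≤g g≤h

  ⊇⇒⪯ : ∀ {F G} → G ⊆ F → F ⪯ G
  ⊇⇒⪯ G⊆F g g∈G = g , G⊆F g∈G , ≤-refl g

  ⁅⁆-⪯ : ∀ {a x} → a ≤ x → ⁅ a ⁆ ⪯ ⁅ x ⁆
  ⁅⁆-⪯ {a} {x} a≤x y y∈⁅x⁆ = a , x∈⁅x⁆ a , subst (a ≤_) (sym (x∈⁅y⁆⇒x≡y x y∈⁅x⁆)) a≤x

  ⪯-𝟘 : ∀ {S F} → S ⪯ F → 𝟘 ∈ F → 𝟘 ∈ S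
  ⪯-𝟘 S⪯F 𝟘∈F with S⪯F 𝟘 𝟘∈F
  ... | s , s∈S , s≤𝟘 = subst (_∈ _) (≤𝟘⇒≡𝟘 s≤𝟘) s∈S

  below? : ∀ S x → Dec (∃ λ s → s ∈ S × s ≤ x)
  below? S x = any? (λ s → (s ∈? S) ×-dec (s ≤? x))

  _⪯?_ : ∀ S F → Dec (S ⪯ F)
  S ⪯? F = all? (λ g → (g ∈? F) →-dec below? S g)

  ∪⁅⁆-⪯-⊕ : ∀ {R b c f} → b + c ≡ f → R ∪ ⁅ f ⁆ ⪯ (R ∪ ⁅ b ⁆) ⊕ (R ∪ ⁅ c ⁆)
  ∪⁅⁆-⪯-⊕ {R} {b} {c} {f} b+c≡f y y∈ with ∈⊕⁻ y∈
  ... | r , q , r∈ , q∈ , refl with x∈p∪q⁻ R ⁅ b ⁆ r∈ | x∈p∪q⁻ R ⁅ c ⁆ q∈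
  ... | inj₁ r∈R | _        = r , x∈p∪q⁺ (inj₁ r∈R) , x≤x+y r q
  ... | inj₂ _   | inj₁ q∈R = q , x∈p∪q⁺ (inj₁ q∈R) , y≤x+y r q
  ... | inj₂ r∈⁅b⁆ | inj₂ q∈⁅c⁆
    rewrite x∈⁅y⁆⇒x≡y b r∈⁅b⁆ | x∈⁅y⁆⇒x≡y c q∈⁅c⁆ =
    f , x∈p∪⁅x⁆ R f , subst (f ≤_) (sym b+c≡f) (≤-refl f)

  replace-below-⪯ : ∀ {G a k} → a ≤ k → (G - k) ∪ ⁅ a ⁆ ⪯ G
  replace-below-⪯ {G} {a} {k} a≤k g g∈G with g ≟ k
  ... | yes refl = a , x∈p∪⁅x⁆ (G - k) a , a≤k
  ... | no g≢k   = g , x∈p∪q⁺ (inj₁ (x∈p∧x≢y⇒x∈p-y g∈G g≢k)) , ≤-refl g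

  atom⇒⁅⁆-atomSet₊ : ∀ {a} → IsAtom a → AtomSet₊ ⁅ a ⁆
  atom⇒⁅⁆-atomSet₊ {a} a-atom =
    (a , x∈⁅x⁆ a) , λ x x∈⁅a⁆ → subst IsAtom (sym (x∈⁅y⁆⇒x≡y a x∈⁅a⁆)) a-atom

  atomic⇒𝟘∉ : ∀ {S} → Atomic S → 𝟘 ∉ S
  atomic⇒𝟘∉ S-atomic 𝟘∈S = proj₁ (S-atomic 𝟘 𝟘∈S) refl

  atomic-⪯-⊕ : ∀ {S F G} → Atomic S → S ⪯ F ⊕ G → S ⪯ F ⊎ S ⪯ G
  atomic-⪯-⊕ {S} {F} {G} S-atomic S⪯F⊕G with any? (λ f → (f ∈? F) ×-dec ¬? (below? S f))
  ... | yes (f , f∈F , nothing-below-f) = inj₂ S⪯G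
    where
    S⪯G : S ⪯ G
    S⪯G g g∈G with S⪯F⊕G (f + g) (∈⊕⁺ f∈F g∈G)
    ... | s , s∈S , s≤f+g with atom-joinPrime (S-atomic s s∈S) s≤f+g
    ... | inj₁ s≤f = ⊥-elim (nothing-below-f (s , s∈S , s≤f))
    ... | inj₂ s≤g = s , s∈S , s≤g
  ... | no ∄f = inj₁ S⪯F
    where
    S⪯F : S ⪯ F
    S⪯F f f∈F with below? S f
    ... | yes found = found
    ... | no nothing-below-f = ⊥-elim (∄f (f , f∈F , nothing-below-f))

  ⪯-atomic⇒⊆ : ∀ {S′ S} → 𝟘 ∉ S′ → Atomic S → S′ ⪯ S → S ⊆ S′
  ⪯-atomic⇒⊆ {S′} 𝟘∉S′ S-atomic S′⪯S {x} x∈S with S′⪯S x x∈S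
  ... | s , s∈S′ , s≤x with proj₂ (S-atomic x x∈S) s s≤x
  ... | inj₁ refl = ⊥-elim (𝟘∉S′ s∈S′)
  ... | inj₂ refl = s∈S′

  ∈σ⁺ : ∀ {K S} → S ∈ᶠ K → AtomSet₊ S → S ∈ᶠ σ B K
  ∈σ⁺ {K} {S} S∈K S-atoms =
    Equivalence.from T-∧ (S∈K , fromWitness {a? = D.atomSet₊? B S} S-atoms)

  ∈σ⁻ : ∀ {K S} → S ∈ᶠ σ B K → S ∈ᶠ K × AtomSet₊ S
  ∈σ⁻ {K} {S} S∈σK with Equivalence.to (T-∧ {K S}) S∈σK
  ... | S∈K , S-atoms = S∈K , toWitness {a? = D.atomSet₊? B S} S-atoms

  σ-mono : ∀ {K K′} → K ⊑ K′ → σ B K ⊑ σ B K′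
  σ-mono {K} {K′} K⊑K′ S S∈σK with ∈σ⁻ {K} S∈σK
  ... | S∈K , S-atoms = ∈σ⁺ {K′} (K⊑K′ S S∈K) S-atoms

  module _ {K : Family n} (U : IsUltracontact B K) where
    open IsUltracontact U

    ∈K⇒nonempty : ∀ {F} → F ∈ᶠ K → Nonempty F
    ∈K⇒nonempty {F} F∈K with nonempty? F
    ... | yes F≠∅ = F≠∅
    ... | no F=∅  = ⊥-elim (K0 (subst (_∈ᶠ K) (Empty-unique F=∅) F∈K))

    ∈K⇒≢𝟘 : ∀ {F x} → F ∈ᶠ K → x ∈ F → x ≢ 𝟘
    ∈K⇒≢𝟘 {F} F∈K x∈F refl = K1 F x∈F F∈K

    atomise-∪⁅⁆ : ∀ R f → (R ∪ ⁅ f ⁆) ∈ᶠ K → ∃ λ a → IsAtom a × a ≤ f × (R ∪ ⁅ a ⁆) ∈ᶠ K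
    atomise-∪⁅⁆ R f = go (<-wellFounded f)
      where
      go : ∀ {f} → Acc _<_ f → (R ∪ ⁅ f ⁆) ∈ᶠ K → ∃ λ a → IsAtom a × a ≤ f × (R ∪ ⁅ a ⁆) ∈ᶠ K
      go {f} (acc rec) R∪f∈K with isAtom? f
      ... | yes f-atom = f , f-atom , ≤-refl f , R∪f∈K
      ... | no ¬atom with nonAtom-split (∈K⇒≢𝟘 R∪f∈K (x∈p∪⁅x⁆ R f)) ¬atom
      ... | b , c , b<f , c<f , b+c≡f =
        [ descend b<f , descend c<f ]′
          (K4 _ _ (K3 _ _ (∪⁅⁆-⪯-⊕ b+c≡f) (b + c , ∈⊕⁺ (x∈p∪⁅x⁆ R b) (x∈p∪⁅x⁆ R c)) R∪f∈K))
        where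
        descend : ∀ {g} → g < f → (R ∪ ⁅ g ⁆) ∈ᶠ K → ∃ λ a → IsAtom a × a ≤ f × (R ∪ ⁅ a ⁆) ∈ᶠ K
        descend g<f R∪g∈K with go (rec g<f) R∪g∈K
        ... | a , a-atom , a≤g , R∪a∈K = a , a-atom , ≤-trans a≤g (proj₁ g<f) , R∪a∈K

    atomise-member : ∀ {G k} → G ∈ᶠ K → k ∈ G →
                     ∃ λ a → IsAtom a × a ≤ k × ((G - k) ∪ ⁅ a ⁆) ∈ᶠ K
    atomise-member {G} {k} G∈K k∈G =
      atomise-∪⁅⁆ (G - k) k (K3 G _ (⊇⇒⪯ (x∈p⇒p-x∪⁅x⁆⊆p k∈G)) (k , x∈p∪⁅x⁆ (G - k) k) G∈K)

    atomise-listed : ∀ {G} (L : List (Fin n)) → G ∈ᶠ K → (∀ x → x ∈ G → IsAtom x ⊎ x ∈ˡ L) →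
                     ∃ λ S → S ∈ᶠ K × S ⪯ G × Atomic S
    atomise-listed {G} [] G∈K listed = G , G∈K , ⪯-refl G , atomic
      where
      atomic : Atomic G
      atomic x x∈G with listed x x∈G
      ... | inj₁ x-atom = x-atom
      ... | inj₂ ()
    atomise-listed {G} (k ∷ L) G∈K listed with k ∈? G
    ... | no k∉G =
      atomise-listed L G∈K (λ x x∈G → map₂ (tail (λ { refl → k∉G x∈G })) (listed x x∈G))
    ... | yes k∈G with atomise-member G∈K k∈G
    ... | a , a-atom , a≤k , G′∈K =
      let S , S∈K , S⪯G′ , S-atomic = atomise-listed L G′∈K listed′
      in S , S∈K , ⪯-trans S⪯G′ (replace-below-⪯ a≤k) , S-atomic
      where
      listed′ : ∀ x → x ∈ (G - k) ∪ ⁅ a ⁆ → IsAtom x ⊎ x ∈ˡ L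
      listed′ x x∈ with x∈p∪q⁻ (G - k) ⁅ a ⁆ x∈
      ... | inj₁ x∈G-k =
        map₂ (tail (x∉⁅y⁆⇒x≢y (x∈p─q⇒x∉q x∈G-k))) (listed x (p─q⊆p G ⁅ k ⁆ x∈G-k))
      ... | inj₂ x∈⁅a⁆ = inj₁ (proj₂ (atom⇒⁅⁆-atomSet₊ a-atom) x x∈⁅a⁆)

    atomic-refinement : ∀ {F} → F ∈ᶠ K → ∃ λ S → S ∈ᶠ K × S ⪯ F × AtomSet₊ S
    atomic-refinement F∈K with atomise-listed (allFin n) F∈K (λ x _ → inj₂ (∈-allFin x))
    ... | S , S∈K , S⪯F , S-atomic = S , S∈K , S⪯F , ∈K⇒nonempty S∈K , S-atomic

    σ-isSimplicialComplex : IsSimplicialComplexOnAtoms B (σ B K)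
    σ-isSimplicialComplex = record
      { faces    = λ S S∈σK → proj₂ (∈σ⁻ {K} S∈σK)
      ; vertices = λ v v-atom → ∈σ⁺ {K} (K2 v (proj₁ v-atom)) (atom⇒⁅⁆-atomSet₊ v-atom)
      ; downward = λ S T S∈σK T≠∅ T⊆S → let S∈K , _ , S-atomic = ∈σ⁻ {K} S∈σK in
                     ∈σ⁺ {K} (K3 S T (⊇⇒⪯ T⊆S) T≠∅ S∈K) (T≠∅ , λ a a∈T → S-atomic a (T⊆S a∈T))
      }

  σ-reflects-⊑ : ∀ {K K′} → IsUltracontact B K → IsUltracontact B K′ → σ B K ⊑ σ B K′ → K ⊑ K′
  σ-reflects-⊑ {K} {K′} U U′ σK⊑σK′ F F∈K with atomic-refinement U F∈K
  ... | S , S∈K , S⪯F , S-atoms =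
    IsUltracontact.K3 U′ S F S⪯F (∈K⇒nonempty U F∈K)
      (proj₁ (∈σ⁻ {K′} (σK⊑σK′ S (∈σ⁺ {K} S∈K S-atoms))))

  Upward : Family n → Subset n → Set
  Upward Σ′ F = Nonempty F × ∃ λ S → S ∈ᶠ Σ′ × S ⪯ F

  upward? : ∀ Σ′ F → Dec (Upward Σ′ F)
  upward? Σ′ F = nonempty? F ×-dec anySubset? (λ S → T? (Σ′ S) ×-dec S ⪯? F)

  ↑ : Family n → Family n
  ↑ Σ′ F = ⌊ upward? Σ′ F ⌋

  ∈↑⁺ : ∀ {Σ′ F} → Upward Σ′ F → F ∈ᶠ ↑ Σ′
  ∈↑⁺ {Σ′} {F} = fromWitness {a? = upward? Σ′ F}

  ∈↑⁻ : ∀ {Σ′ F} → F ∈ᶠ ↑ Σ′ → Upward Σ′ F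
  ∈↑⁻ {Σ′} {F} = toWitness {a? = upward? Σ′ F}

  module _ {Σ′ : Family n} (Δ : IsSimplicialComplexOnAtoms B Σ′) where
    open IsSimplicialComplexOnAtoms Δ

    ↑-isUltracontact : IsUltracontact B (↑ Σ′)
    ↑-isUltracontact = record
      { K0 = λ ∅∈↑Σ → ∉⊥ (proj₂ (proj₁ (∈↑⁻ {Σ′} ∅∈↑Σ)))
      ; K1 = λ F 𝟘∈F F∈↑Σ → let _ , S , S∈Σ , S⪯F = ∈↑⁻ {Σ′} F∈↑Σ in
               atomic⇒𝟘∉ (proj₂ (faces S S∈Σ)) (⪯-𝟘 S⪯F 𝟘∈F)
      ; K2 = λ x x≢𝟘 → let a , a-atom , a≤x = atom-below x≢𝟘 in
               ∈↑⁺ {Σ′} ((x , x∈⁅x⁆ x) , ⁅ a ⁆ , vertices a a-atom , ⁅⁆-⪯ a≤x)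
      ; K3 = λ F G F⪯G G≠∅ F∈↑Σ → let _ , S , S∈Σ , S⪯F = ∈↑⁻ {Σ′} F∈↑Σ in
               ∈↑⁺ {Σ′} (G≠∅ , S , S∈Σ , ⪯-trans S⪯F F⪯G)
      ; K4 = ↑-K4
      }
      where
      ↑-K4 : ∀ F G → (F ⊕ G) ∈ᶠ ↑ Σ′ → F ∈ᶠ ↑ Σ′ ⊎ G ∈ᶠ ↑ Σ′
      ↑-K4 F G F⊕G∈↑Σ with ∈↑⁻ {Σ′} F⊕G∈↑Σ
      ... | (y , y∈F⊕G) , S , S∈Σ , S⪯F⊕G with ∈⊕⁻ y∈F⊕G
      ... | f , g , f∈F , g∈G , _ =
        [ (λ S⪯F → inj₁ (∈↑⁺ {Σ′} ((f , f∈F) , S , S∈Σ , S⪯F)))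
        , (λ S⪯G → inj₂ (∈↑⁺ {Σ′} ((g , g∈G) , S , S∈Σ , S⪯G)))
        ]′
          (atomic-⪯-⊕ (proj₂ (faces S S∈Σ)) S⪯F⊕G)

    σ↑≐ : σ B (↑ Σ′) ≐ Σ′
    σ↑≐ = σ↑⊑ , λ S S∈Σ →
      ∈σ⁺ {↑ Σ′} (∈↑⁺ {Σ′} (proj₁ (faces S S∈Σ) , S , S∈Σ , ⪯-refl S)) (faces S S∈Σ)
      where
      σ↑⊑ : σ B (↑ Σ′) ⊑ Σ′
      σ↑⊑ S S∈σ↑Σ with ∈σ⁻ {↑ Σ′} S∈σ↑Σ
      ... | S∈↑Σ , S≠∅ , S-atomic with ∈↑⁻ {Σ′} S∈↑Σ
      ... | _ , S′ , S′∈Σ , S′⪯S =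
        downward S′ S S′∈Σ S≠∅ (⪯-atomic⇒⊆ (atomic⇒𝟘∉ (proj₂ (faces S′ S′∈Σ))) S-atomic S′⪯S)

theorem7p4 : (n : ℕ) (B : FinBA n) → FinBA.𝟙 B ≢ FinBA.𝟘 B →
    ((𝒦 : Family n) → IsUltracontact B 𝒦 → IsSimplicialComplexOnAtoms B (σ B 𝒦))
    × ((𝒦 𝒦′ : Family n) → IsUltracontact B 𝒦 → IsUltracontact B 𝒦′ →
        (𝒦 ⊑ 𝒦′) ⇔ (σ B 𝒦 ⊑ σ B 𝒦′))
    × ((Σ′ : Family n) → IsSimplicialComplexOnAtoms B Σ′ →
        ∃ (λ 𝒦 → IsUltracontact B 𝒦 × (σ B 𝒦 ≐ Σ′)))
theorem7p4 n B _ =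
    (λ _ → σ-isSimplicialComplex B)
  , (λ _ _ U U′ → mk⇔ (σ-mono B) (σ-reflects-⊑ B U U′))
  , (λ Σ′ Δ → ↑ B Σ′ , ↑-isUltracontact B Δ , σ↑≐ B Δ)
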